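{- The quasi-orders $\sqsubseteq^\circ_{\mathrm{FO}}$ and $\sqsubseteq_{\mathrm{FO}}$ on graph classes are join semi-lattices. In both quasi-orders the join of two classes $\mathcal C$ and $\mathcal D$ is the class $\mathcal C\cup\mathcal D$: that is, $\mathcal C\sqsubseteq\mathcal C\cup\mathcal D$, $\mathcal D\sqsubseteq\mathcal C\cup\mathcal D$, and for every class $\mathcal F$ with $\mathcal C\sqsubseteq\mathcal F$ and $\mathcal D\sqsubseteq\mathcal F$ we have $\mathcal C\cup\mathcal D\sqsubseteq\mathcal F$ (for $\sqsubseteq$ either of the two quasi-orders).
   Context: All graphs are finite, simple, undirected. A $\Sigma$-expansion of $G$ ($\Sigma$ a finite set of unary symbols) is $G$ with a subset of $V(G)$ for each symbol. A simple interpretation $(\nu(x),\eta(x,y))$ of first-order formulas over $\{E\}\cup\Sigma$ ($\eta$ symmetric, antireflexive) produces from $G^+$ the graph on $\nu(G^+)$ with edges $uv$ where $G^+\models\eta(u,v)$. A non-copying transduction is a pair $(\Sigma,\mathsf I)$, producing from $G$ all $\mathsf I(G^+)$. The $k$-copy operation maps $G$ to $k$ disjoint copies of $G$ with copies of each vertex made pairwise adjacent. A transduction is a finite composition of copy operations and non-copying transductions. $\mathcal C\sqsubseteq_{\mathrm{FO}}\mathcal D$ (resp. $\mathcal C\sqsubseteq^\circ_{\mathrm{FO}}\mathcal D$) means there is a transduction (resp. non-copying transduction) $\mathsf T$ such that every graph of $\mathcal C$ is produced by $\mathsf T$ from some graph of $\mathcal D$. -}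

module Defs where

open import Data.Nat using (ℕ; zero; suc; _*_)
open import Data.Fin using (Fin; zero; suc; _≟_; remQuot)
open import Data.Bool using (Bool; true; false; not; _∧_; _∨_; if_then_else_)
open import Data.Product using (Σ; Σ-syntax; _×_; _,_; proj₁; proj₂)
open import Data.Vec.Functional using ([]; _∷_)
open import Relation.Nullary using (yes; no; ¬_)
open import Relation.Nullary.Decidable using (⌊_⌋)
open import Relation.Binary.PropositionalEquality using (_≡_; refl; sym; cong)
open import Relation.Unary using (Pred; _∪_)
open import Function using (_∘_)
open import Function.Bundles using (_↔_; Inverse)
open import Level using (0ℓ)

record Graph : Set where
  field
    n   : ℕ
    adj : Fin n → Fin n → Bool
    adj-sym : ∀ u v → adj u v ≡ adj v u
    adj-irr : ∀ u → adj u u ≡ false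
open Graph public

_≅_ : Graph → Graph → Set
G ≅ H = Σ[ f ∈ (Fin (n G) ↔ Fin (n H)) ]
          (∀ u v → adj H (Inverse.to f u) (Inverse.to f v) ≡ adj G u v)

Class : Set₁
Class = Pred Graph 0ℓ

-- First-order formulas over {E} ∪ Σ, Σ = Fin s unary symbols,
-- with k free variables (de Bruijn indices in Fin k)

data Formula (s : ℕ) : ℕ → Set where
  E    : ∀ {k} → Fin k → Fin k → Formula s k
  Eq   : ∀ {k} → Fin k → Fin k → Formula s k
  P    : ∀ {k} → Fin s → Fin k → Formula s k
  Neg  : ∀ {k} → Formula s k → Formula s k
  And  : ∀ {k} → Formula s k → Formula s k → Formula s k
  Ex   : ∀ {k} → Formula s (suc k) → Formula s k

record Expanded (s : ℕ) : Set where
  constructor expand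
  field
    graph : Graph
    col   : Fin s → Fin (n graph) → Bool
open Expanded public

anyFin : ∀ {m} → (Fin m → Bool) → Bool
anyFin {zero}  f = false
anyFin {suc m} f = f zero ∨ anyFin (f ∘ suc)

eval : ∀ {s k} (G⁺ : Expanded s) → Formula s k →
       (Fin k → Fin (n (graph G⁺))) → Bool
eval G⁺ (E i j)   ρ = adj (graph G⁺) (ρ i) (ρ j)
eval G⁺ (Eq i j)  ρ = ⌊ ρ i ≟ ρ j ⌋
eval G⁺ (P c i)   ρ = col G⁺ c (ρ i)
eval G⁺ (Neg φ)   ρ = not (eval G⁺ φ ρ)
eval G⁺ (And φ ψ) ρ = eval G⁺ φ ρ ∧ eval G⁺ ψ ρ
eval G⁺ (Ex φ)    ρ = anyFin (λ v → eval G⁺ φ (v ∷ ρ))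

record Interpretation (s : ℕ) : Set where
  field
    ν     : Formula s 1
    η     : Formula s 2
    η-sym : ∀ (G⁺ : Expanded s) u v →
            eval G⁺ η (u ∷ v ∷ []) ≡ eval G⁺ η (v ∷ u ∷ [])
    η-irr : ∀ (G⁺ : Expanded s) u → eval G⁺ η (u ∷ u ∷ []) ≡ false
open Interpretation public

select : ∀ {m} → (Fin m → Bool) → Σ[ k ∈ ℕ ] (Fin k → Fin m)
select {zero}  p = zero , λ ()
select {suc m} p with select (p ∘ suc) | p zero
... | k , f | true  = suc k , λ { zero → zero ; (suc i) → suc (f i) }
... | k , f | false = k , suc ∘ f

apply : ∀ {s} → Interpretation s → Expanded s → Graph
apply I G⁺ = record
  { n   = proj₁ sel
  ; adj = λ a b → eval G⁺ (η I) (proj₂ sel a ∷ proj₂ sel b ∷ [])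
  ; adj-sym = λ a b → η-sym I G⁺ (proj₂ sel a) (proj₂ sel b)
  ; adj-irr = λ a → η-irr I G⁺ (proj₂ sel a)
  }
  where sel = select (λ v → eval G⁺ (ν I) (v ∷ []))

-- k-copy operation: vertex (i , u) ∈ Fin k × Fin n encoded in Fin (k * n)

copyAdjP : ∀ {k m} (A : Fin m → Fin m → Bool) →
           Fin k × Fin m → Fin k × Fin m → Bool
copyAdjP A (i , u) (j , v) with i ≟ j
... | yes _ = A u v
... | no  _ = ⌊ u ≟ v ⌋

private
  ⌊≟⌋-sym : ∀ {m} (u v : Fin m) → ⌊ u ≟ v ⌋ ≡ ⌊ v ≟ u ⌋
  ⌊≟⌋-sym u v with u ≟ v | v ≟ u
  ... | yes _ | yes _ = refl
  ... | no  _ | no  _ = refl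
  ... | yes p | no ¬q = Data.Empty.⊥-elim (¬q (sym p))
    where import Data.Empty
  ... | no ¬p | yes q = Data.Empty.⊥-elim (¬p (sym q))
    where import Data.Empty

  copyAdjP-sym : ∀ {k} (G : Graph) (p q : Fin k × Fin (n G)) →
                 copyAdjP (adj G) p q ≡ copyAdjP (adj G) q p
  copyAdjP-sym G (i , u) (j , v) with i ≟ j | j ≟ i
  ... | yes _ | yes _ = adj-sym G u v
  ... | no  _ | no  _ = ⌊≟⌋-sym u v
  ... | yes p | no ¬q = Data.Empty.⊥-elim (¬q (sym p))
    where import Data.Empty
  ... | no ¬p | yes q = Data.Empty.⊥-elim (¬p (sym q))
    where import Data.Empty

  copyAdjP-irr : ∀ {k} (G : Graph) (p : Fin k × Fin (n G)) →
                 copyAdjP (adj G) p p ≡ false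
  copyAdjP-irr G (i , u) with i ≟ i
  ... | yes _ = adj-irr G u
  ... | no ¬p = Data.Empty.⊥-elim (¬p refl)
    where import Data.Empty

copy : ℕ → Graph → Graph
copy k G = record
  { n   = k * n G
  ; adj = λ a b → copyAdjP (adj G) (remQuot {k} (n G) a) (remQuot {k} (n G) b)
  ; adj-sym = λ a b → copyAdjP-sym G (remQuot {k} (n G) a) (remQuot {k} (n G) b)
  ; adj-irr = λ a → copyAdjP-irr G (remQuot {k} (n G) a)
  }

data Transduction : Set where
  nonCopying : (s : ℕ) → Interpretation s → Transduction
  copyOp     : ℕ → Transduction
  _⨾_        : Transduction → Transduction → Transduction   -- first, then second

Produces : Transduction → Graph → Graph → Set
Produces (nonCopying s I) G H = Σ[ c ∈ (Fin s → Fin (n G) → Bool) ] (apply I (expand G c) ≅ H)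
Produces (copyOp k)       G H = copy k G ≅ H
Produces (T₁ ⨾ T₂)        G H = Σ[ K ∈ Graph ] (Produces T₁ G K × Produces T₂ K H)

_⊑FO_ : Class → Class → Set
C ⊑FO D = Σ[ T ∈ Transduction ] (∀ G → C G → Σ[ H ∈ Graph ] (D H × Produces T H G))

_⊑°FO_ : Class → Class → Set
C ⊑°FO D = Σ[ s ∈ ℕ ] Σ[ I ∈ Interpretation s ]
  (∀ G → C G → Σ[ H ∈ Graph ] (D H × Produces (nonCopying s I) H G))

IsJoinByUnion : (Class → Class → Set) → Set₁
IsJoinByUnion _⊑_ = ∀ (C D : Class) →
  (C ⊑ (C ∪ D)) × (D ⊑ (C ∪ D)) ×
  (∀ (F : Class) → C ⊑ F → D ⊑ F → (C ∪ D) ⊑ F)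

-- A fresh unary predicate can switch between two interpretations: where it holds the first one
-- is evaluated, where it fails the second, so one non-copying transduction produces everything
-- produced by either.  Copy operations cannot be switched off in this way, so for general
-- transductions each T is replaced by an "optional" T' producing everything T produces and also
-- every graph from itself: a k-copy with k > 0 is followed by a restriction that may keep only the
-- first copy, the 0-copy becomes a restriction to the empty set.  Then T₁' ⨾ T₂' produces the
-- union of what T₁ and T₂ produce.
module Submission where

open import Defs
open import Data.Nat using (zero; suc; _+_)
open import Data.Fin using (Fin; zero; suc; _≟_; remQuot; combine; _↑ˡ_; _↑ʳ_; splitAt)
open import Data.Fin.Properties using (suc-injective; remQuot-combine; combine-remQuot; splitAt-↑ˡ; splitAt-↑ʳ)
open import Data.Bool using (Bool; true; false; not; _∧_; _∨_; if_then_else_)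
open import Data.Product using (_×_; Σ-syntax; _,_; proj₁; proj₂; uncurry)
open import Data.Sum using (inj₁; inj₂; [_,_]′)
open import Data.Empty using (⊥; ⊥-elim)
open import Data.Vec.Functional using ([]; _∷_)
open import Relation.Nullary using (yes; no)
open import Relation.Binary.PropositionalEquality using (_≡_; refl; sym; trans; cong; cong₂; module ≡-Reasoning)
open import Relation.Unary using (_∪_; _⊆_)
open import Function using (_∘_; case_of_)
open import Function.Bundles using (Inverse; mk↔ₛ′)
open import Function.Properties.Inverse using (↔-refl; ↔-trans)

select-satisfies : ∀ {m} (p : Fin m → Bool) i → p (proj₂ (select p) i) ≡ true
select-satisfies {suc m} p i with select (p ∘ suc) | p zero in eq | select-satisfies (p ∘ suc)
select-satisfies {suc m} p zero    | k , f | true  | ih = eq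
select-satisfies {suc m} p (suc i) | k , f | true  | ih = ih i
select-satisfies {suc m} p i       | k , f | false | ih = ih i

select-injective : ∀ {m} (p : Fin m → Bool) i j → proj₂ (select p) i ≡ proj₂ (select p) j → i ≡ j
select-injective {suc m} p i j with select (p ∘ suc) | p zero | select-injective (p ∘ suc)
select-injective {suc m} p zero    zero    | k , f | true  | ih = λ _ → refl
select-injective {suc m} p zero    (suc j) | k , f | true  | ih = λ ()
select-injective {suc m} p (suc i) zero    | k , f | true  | ih = λ ()
select-injective {suc m} p (suc i) (suc j) | k , f | true  | ih = cong suc ∘ ih i j ∘ suc-injective
select-injective {suc m} p i       j       | k , f | false | ih = ih i j ∘ suc-injective

select-complete : ∀ {m} (p : Fin m → Bool) v → p v ≡ true →
                  Σ[ i ∈ Fin (proj₁ (select p)) ] proj₂ (select p) i ≡ v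
select-complete {suc m} p v with select (p ∘ suc) | p zero in eq | select-complete (p ∘ suc)
select-complete {suc m} p zero    | k , f | true  | ih = λ _ → zero , refl
select-complete {suc m} p (suc v) | k , f | true  | ih = λ pv → let i , e = ih v pv in suc i , cong suc e
select-complete {suc m} p zero    | k , f | false | ih = λ pv → case trans (sym eq) pv of λ ()
select-complete {suc m} p (suc v) | k , f | false | ih = λ pv → let i , e = ih v pv in i , cong suc e

≅-refl : ∀ {A} → A ≅ A
≅-refl = ↔-refl , λ _ _ → refl

≅-trans : ∀ {A B C} → A ≅ B → B ≅ C → A ≅ C
≅-trans (f , f-adj) (g , g-adj) = ↔-trans f g , λ u v → trans (g-adj _ _) (f-adj u v)

apply≅-byEmbedding : ∀ {s} (I : Interpretation s) (G⁺ : Expanded s) (H : Graph)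
          (g : Fin (n H) → Fin (n (graph G⁺))) →
          (∀ j j' → g j ≡ g j' → j ≡ j') →
          (∀ j → eval G⁺ (ν I) (g j ∷ []) ≡ true) →
          (∀ v → eval G⁺ (ν I) (v ∷ []) ≡ true → Σ[ j ∈ Fin (n H) ] g j ≡ v) →
          (∀ j j' → adj H j j' ≡ eval G⁺ (η I) (g j ∷ g j' ∷ [])) →
          apply I G⁺ ≅ H
apply≅-byEmbedding I G⁺ H g g-inj g-ν g-onto g-adj =
  mk↔ₛ′ to from (λ j → g-inj _ _ (trans (g∘to (from j)) (f∘from j)))
                (λ i → select-injective p _ _ (trans (f∘from (to i)) (g∘to i)))
  , λ i i' → trans (g-adj (to i) (to i'))
                   (cong₂ (λ a b → eval G⁺ (η I) (a ∷ b ∷ [])) (g∘to i) (g∘to i'))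
  where
  p = λ v → eval G⁺ (ν I) (v ∷ [])
  f = proj₂ (select p)
  to : Fin (proj₁ (select p)) → Fin (n H)
  to i = proj₁ (g-onto (f i) (select-satisfies p i))
  g∘to : ∀ i → g (to i) ≡ f i
  g∘to i = proj₂ (g-onto (f i) (select-satisfies p i))
  from : Fin (n H) → Fin (proj₁ (select p))
  from j = proj₁ (select-complete p (g j) (g-ν j))
  f∘from : ∀ j → f (from j) ≡ g j
  f∘from j = proj₂ (select-complete p (g j) (g-ν j))

apply-cong : ∀ {s t} (I : Interpretation s) (J : Interpretation t) (G : Graph)
             (c : Fin s → Fin (n G) → Bool) (d : Fin t → Fin (n G) → Bool) (H : Graph) →
             (∀ v → eval (expand G c) (ν I) (v ∷ []) ≡ eval (expand G d) (ν J) (v ∷ [])) →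
             (∀ u v → eval (expand G c) (η I) (u ∷ v ∷ []) ≡ eval (expand G d) (η J) (u ∷ v ∷ [])) →
             apply J (expand G d) ≅ H → apply I (expand G c) ≅ H
apply-cong I J G c d H ν-eq η-eq =
  ≅-trans {apply I (expand G c)} {apply J (expand G d)} {H}
    (apply≅-byEmbedding I (expand G c) (apply J (expand G d)) (proj₂ (select q)) (select-injective q)
             (λ j → trans (ν-eq _) (select-satisfies q j))
             (λ v h → select-complete q v (trans (sym (ν-eq v)) h))
             (λ j j' → sym (η-eq _ _)))
  where q = λ v → eval (expand G d) (ν J) (v ∷ [])

relabel : ∀ {a b k} → (Fin a → Fin b) → Formula a k → Formula b k
relabel r (E i j)   = E i j
relabel r (Eq i j)  = Eq i j
relabel r (P x i)   = P (r x) i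
relabel r (Neg φ)   = Neg (relabel r φ)
relabel r (And φ ψ) = And (relabel r φ) (relabel r ψ)
relabel r (Ex φ)    = Ex (relabel r φ)

anyFin-cong : ∀ {m} (f g : Fin m → Bool) → (∀ v → f v ≡ g v) → anyFin f ≡ anyFin g
anyFin-cong {zero}  f g f≗g = refl
anyFin-cong {suc m} f g f≗g = cong₂ _∨_ (f≗g zero) (anyFin-cong (f ∘ suc) (g ∘ suc) (f≗g ∘ suc))

eval-relabel : ∀ {a b k} (r : Fin a → Fin b) (G : Graph)
               (c : Fin b → Fin (n G) → Bool) (c' : Fin a → Fin (n G) → Bool) →
               (∀ x v → c (r x) v ≡ c' x v) →
               (φ : Formula a k) (ρ : Fin k → Fin (n G)) →
               eval (expand G c) (relabel r φ) ρ ≡ eval (expand G c') φ ρ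
eval-relabel r G c c' h (E i j)   ρ = refl
eval-relabel r G c c' h (Eq i j)  ρ = refl
eval-relabel r G c c' h (P x i)   ρ = h x (ρ i)
eval-relabel r G c c' h (Neg φ)   ρ = cong not (eval-relabel r G c c' h φ ρ)
eval-relabel r G c c' h (And φ ψ) ρ = cong₂ _∧_ (eval-relabel r G c c' h φ ρ) (eval-relabel r G c c' h ψ ρ)
eval-relabel r G c c' h (Ex φ)    ρ = anyFin-cong _ _ (λ v → eval-relabel r G c c' h φ (v ∷ ρ))

none all : ∀ {s m} → Fin s → Fin m → Bool
none _ _ = false
all  _ _ = true

restriction : Interpretation 1
restriction = record
  { ν     = P zero zero
  ; η     = E zero (suc zero)
  ; η-sym = λ G⁺ → adj-sym (graph G⁺)
  ; η-irr = λ G⁺ → adj-irr (graph G⁺)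
  }

restriction-all : ∀ G → apply restriction (expand G all) ≅ G
restriction-all G = apply≅-byEmbedding restriction (expand G all) G
                      (λ j → j) (λ _ _ e → e) (λ _ → refl) (λ v _ → v , refl) (λ _ _ → refl)

restriction-empty : ∀ G H → copy 0 G ≅ H → apply restriction (expand G none) ≅ H
restriction-empty G H (f , _) =
  apply≅-byEmbedding restriction (expand G none) H
    (⊥-elim ∘ no-vertex) (⊥-elim ∘ no-vertex) (⊥-elim ∘ no-vertex) (λ _ ()) (⊥-elim ∘ no-vertex)
  where
  no-vertex : Fin (n H) → ⊥
  no-vertex j with Inverse.from f j
  ... | ()

isFirst : ∀ {k} → Fin k → Bool
isFirst zero    = true
isFirst (suc _) = false

firstCopy : ∀ k G → Fin 1 → Fin (n (copy (suc k) G)) → Bool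
firstCopy k G _ v = isFirst (proj₁ (remQuot {suc k} (n G) v))

restriction-firstCopy : ∀ k G → apply restriction (expand (copy (suc k) G) (firstCopy k G)) ≅ G
restriction-firstCopy k G = apply≅-byEmbedding restriction (expand (copy (suc k) G) (firstCopy k G))
                              G embed inj first onto adjacent
  where
  embed : Fin (n G) → Fin (n (copy (suc k) G))
  embed = combine {suc k} zero
  decode : ∀ u → remQuot {suc k} (n G) (embed u) ≡ (zero , u)
  decode = remQuot-combine zero
  inj : ∀ u u' → embed u ≡ embed u' → u ≡ u'
  inj u u' e = cong proj₂ (trans (sym (decode u)) (trans (cong (remQuot (n G)) e) (decode u')))
  first : ∀ u → firstCopy k G zero (embed u) ≡ true
  first u = cong (isFirst ∘ proj₁) (decode u)
  onto : ∀ v → firstCopy k G zero v ≡ true → Σ[ u ∈ Fin (n G) ] embed u ≡ v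
  onto v = decoded (remQuot {suc k} (n G) v) refl
    where
    decoded : ∀ r → remQuot {suc k} (n G) v ≡ r → isFirst (proj₁ r) ≡ true → Σ[ u ∈ Fin (n G) ] embed u ≡ v
    decoded (zero  , u) eq _ = u , trans (cong (uncurry combine) (sym eq)) (combine-remQuot (n G) v)
    decoded (suc _ , _) _ ()
  same-copy : ∀ u u' → copyAdjP {suc k} (adj G) (zero , u) (zero , u') ≡ adj G u u'
  same-copy u u' with zero {k} ≟ zero
  ... | yes _ = refl
  ... | no z≢z = ⊥-elim (z≢z refl)
  adjacent : ∀ u u' → adj G u u' ≡ adj (copy (suc k) G) (embed u) (embed u')
  adjacent u u' = sym (trans (cong₂ (copyAdjP (adj G)) (decode u) (decode u')) (same-copy u u'))

-- The edge relation of the choice interpretation, x and y being the selector bits of the endpoints.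
agree : Bool → Bool → Bool → Bool → Bool
agree true  true  p q = p
agree false false p q = q
agree _     _     p q = false

agree-sym : ∀ x y p q → agree x y p q ≡ agree y x p q
agree-sym true  true  p q = refl
agree-sym true  false p q = refl
agree-sym false true  p q = refl
agree-sym false false p q = refl

agree-irr : ∀ x → agree x x false false ≡ false
agree-irr true  = refl
agree-irr false = refl

not∧not-agree : ∀ x y p q → not (not ((x ∧ y) ∧ p) ∧ not ((not x ∧ not y) ∧ q)) ≡ agree x y p q
not∧not-agree true  true  true  q     = refl
not∧not-agree true  true  false q     = refl
not∧not-agree true  false p     q     = refl
not∧not-agree false true  p     q     = refl
not∧not-agree false false p     true  = refl
not∧not-agree false false p     false = refl

not∧not-if : ∀ b p q → not (not (b ∧ p) ∧ not (not b ∧ q)) ≡ (if b then p else q)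
not∧not-if true  true  q     = refl
not∧not-if true  false q     = refl
not∧not-if false p     true  = refl
not∧not-if false p     false = refl

_∨ᶠ_ : ∀ {s k} → Formula s k → Formula s k → Formula s k
φ ∨ᶠ ψ = Neg (And (Neg φ) (Neg ψ))

module Choice {s₁ s₂} (I₁ : Interpretation s₁) (I₂ : Interpretation s₂) where

  left : Fin s₁ → Fin (suc (s₁ + s₂))
  left x = suc (x ↑ˡ s₂)

  right : Fin s₂ → Fin (suc (s₁ + s₂))
  right x = suc (s₁ ↑ʳ x)

  -- Symbol zero is the selector.
  νᶜ : Formula (suc (s₁ + s₂)) 1
  νᶜ = And (P zero zero) (relabel left (ν I₁)) ∨ᶠ And (Neg (P zero zero)) (relabel right (ν I₂))

  ηᶜ : Formula (suc (s₁ + s₂)) 2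
  ηᶜ = And (And (P zero zero) (P zero (suc zero))) (relabel left (η I₁))
    ∨ᶠ And (And (Neg (P zero zero)) (Neg (P zero (suc zero)))) (relabel right (η I₂))

  module _ (G⁺ : Expanded (suc (s₁ + s₂))) where

    η₁ η₂ : Fin (n (graph G⁺)) → Fin (n (graph G⁺)) → Bool
    η₁ u v = eval G⁺ (relabel left (η I₁)) (u ∷ v ∷ [])
    η₂ u v = eval G⁺ (relabel right (η I₂)) (u ∷ v ∷ [])

    eval-νᶜ : ∀ v → eval G⁺ νᶜ (v ∷ []) ≡
              (if col G⁺ zero v then eval G⁺ (relabel left (ν I₁)) (v ∷ [])
                                else eval G⁺ (relabel right (ν I₂)) (v ∷ []))
    eval-νᶜ v = not∧not-if (col G⁺ zero v) (eval G⁺ (relabel left (ν I₁)) (v ∷ []))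
                                           (eval G⁺ (relabel right (ν I₂)) (v ∷ []))

    eval-ηᶜ : ∀ u v → eval G⁺ ηᶜ (u ∷ v ∷ []) ≡ agree (col G⁺ zero u) (col G⁺ zero v) (η₁ u v) (η₂ u v)
    eval-ηᶜ u v = not∧not-agree (col G⁺ zero u) (col G⁺ zero v) (η₁ u v) (η₂ u v)

    relabel-η-sym : ∀ {s} (I : Interpretation s) (r : Fin s → Fin (suc (s₁ + s₂))) u v →
                    eval G⁺ (relabel r (η I)) (u ∷ v ∷ []) ≡ eval G⁺ (relabel r (η I)) (v ∷ u ∷ [])
    relabel-η-sym I r u v = trans (eval-relabel r _ _ _ (λ _ _ → refl) (η I) _)
                           (trans (η-sym I _ u v) (sym (eval-relabel r _ _ _ (λ _ _ → refl) (η I) _)))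

    relabel-η-irr : ∀ {s} (I : Interpretation s) (r : Fin s → Fin (suc (s₁ + s₂))) u →
                    eval G⁺ (relabel r (η I)) (u ∷ u ∷ []) ≡ false
    relabel-η-irr I r u = trans (eval-relabel r _ _ _ (λ _ _ → refl) (η I) _) (η-irr I _ u)

    ηᶜ-sym : ∀ u v → eval G⁺ ηᶜ (u ∷ v ∷ []) ≡ eval G⁺ ηᶜ (v ∷ u ∷ [])
    ηᶜ-sym u v = begin
      eval G⁺ ηᶜ (u ∷ v ∷ [])          ≡⟨ eval-ηᶜ u v ⟩
      agree x y (η₁ u v) (η₂ u v)      ≡⟨ cong₂ (agree x y) (relabel-η-sym I₁ left u v) (relabel-η-sym I₂ right u v) ⟩
      agree x y (η₁ v u) (η₂ v u)      ≡⟨ agree-sym x y _ _ ⟩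
      agree y x (η₁ v u) (η₂ v u)      ≡⟨ sym (eval-ηᶜ v u) ⟩
      eval G⁺ ηᶜ (v ∷ u ∷ [])          ∎
      where
      open ≡-Reasoning
      x = col G⁺ zero u
      y = col G⁺ zero v

    ηᶜ-irr : ∀ u → eval G⁺ ηᶜ (u ∷ u ∷ []) ≡ false
    ηᶜ-irr u = trans (eval-ηᶜ u u)
               (trans (cong₂ (agree x x) (relabel-η-irr I₁ left u) (relabel-η-irr I₂ right u)) (agree-irr x))
      where x = col G⁺ zero u

  choice : Interpretation (suc (s₁ + s₂))
  choice = record { ν = νᶜ ; η = ηᶜ ; η-sym = ηᶜ-sym ; η-irr = ηᶜ-irr }

  colouring : ∀ {m} → Bool → (Fin s₁ → Fin m → Bool) → (Fin s₂ → Fin m → Bool) →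
              Fin (suc (s₁ + s₂)) → Fin m → Bool
  colouring b c₁ c₂ zero    = λ _ → b
  colouring b c₁ c₂ (suc x) = [ c₁ , c₂ ]′ (splitAt s₁ x)

  colouring-left : ∀ {m} b c₁ c₂ x (v : Fin m) → colouring b c₁ c₂ (left x) v ≡ c₁ x v
  colouring-left b c₁ c₂ x v = cong (λ z → [ c₁ , c₂ ]′ z v) (splitAt-↑ˡ s₁ x s₂)

  colouring-right : ∀ {m} b c₁ c₂ x (v : Fin m) → colouring b c₁ c₂ (right x) v ≡ c₂ x v
  colouring-right b c₁ c₂ x v = cong (λ z → [ c₁ , c₂ ]′ z v) (splitAt-↑ʳ s₁ s₂ x)

  choice-left : ∀ G c₁ c₂ H → apply I₁ (expand G c₁) ≅ H → apply choice (expand G (colouring true c₁ c₂)) ≅ H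
  choice-left G c₁ c₂ H = apply-cong choice I₁ G (colouring true c₁ c₂) c₁ H
    (λ v → trans (eval-νᶜ G⁺ v) (eval-relabel left G _ c₁ (colouring-left true c₁ c₂) (ν I₁) _))
    (λ u v → trans (eval-ηᶜ G⁺ u v) (eval-relabel left G _ c₁ (colouring-left true c₁ c₂) (η I₁) _))
    where G⁺ = expand G (colouring true c₁ c₂)

  choice-right : ∀ G c₁ c₂ H → apply I₂ (expand G c₂) ≅ H → apply choice (expand G (colouring false c₁ c₂)) ≅ H
  choice-right G c₁ c₂ H = apply-cong choice I₂ G (colouring false c₁ c₂) c₂ H
    (λ v → trans (eval-νᶜ G⁺ v) (eval-relabel right G _ c₂ (colouring-right false c₁ c₂) (ν I₂) _))
    (λ u v → trans (eval-ηᶜ G⁺ u v) (eval-relabel right G _ c₂ (colouring-right false c₁ c₂) (η I₂) _))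
    where G⁺ = expand G (colouring false c₁ c₂)

open Choice using (choice; colouring; choice-left; choice-right)

⊑°FO⇒⊑FO : ∀ {C D} → C ⊑°FO D → C ⊑FO D
⊑°FO⇒⊑FO (s , I , h) = nonCopying s I , h

⊆⇒⊑°FO : ∀ {C D} → C ⊆ D → C ⊑°FO D
⊆⇒⊑°FO C⊆D = 1 , restriction , λ G G∈C → G , C⊆D G∈C , all , restriction-all G

⊆⇒⊑FO : ∀ {C D} → C ⊆ D → C ⊑FO D
⊆⇒⊑FO = ⊑°FO⇒⊑FO ∘ ⊆⇒⊑°FO

∪-⊑°FO : ∀ {C D F} → C ⊑°FO F → D ⊑°FO F → (C ∪ D) ⊑°FO F
∪-⊑°FO (s₁ , I₁ , h₁) (s₂ , I₂ , h₂) = _ , choice I₁ I₂ , λ where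
  G (inj₁ G∈C) → let H , H∈F , c₁ , iso = h₁ G G∈C in
    H , H∈F , colouring I₁ I₂ true c₁ none , choice-left I₁ I₂ H c₁ none G iso
  G (inj₂ G∈D) → let H , H∈F , c₂ , iso = h₂ G G∈D in
    H , H∈F , colouring I₁ I₂ false none c₂ , choice-right I₁ I₂ H none c₂ G iso

optional : Transduction → Transduction
optional (nonCopying s I) = nonCopying _ (choice I restriction)
optional (copyOp zero)    = nonCopying 1 restriction
optional (copyOp (suc k)) = copyOp (suc k) ⨾ nonCopying 1 restriction
optional (T₁ ⨾ T₂)        = optional T₁ ⨾ optional T₂

optional-refl : ∀ T G → Produces (optional T) G G
optional-refl (nonCopying s I) G =
  colouring I restriction false none all , choice-right I restriction G none all G (restriction-all G)
optional-refl (copyOp zero)    G = all , restriction-all G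
optional-refl (copyOp (suc k)) G =
  copy (suc k) G , ≅-refl {copy (suc k) G} , firstCopy k G , restriction-firstCopy k G
optional-refl (T₁ ⨾ T₂)        G = G , optional-refl T₁ G , optional-refl T₂ G

optional-extends : ∀ T {G H} → Produces T G H → Produces (optional T) G H
optional-extends (nonCopying s I) {G} {H} (c , iso) =
  colouring I restriction true c none , choice-left I restriction G c none H iso
optional-extends (copyOp zero)    {G} {H} iso = none , restriction-empty G H iso
optional-extends (copyOp (suc k)) {H = H} iso = H , iso , all , restriction-all H
optional-extends (T₁ ⨾ T₂) (K , G→K , K→H) = K , optional-extends T₁ G→K , optional-extends T₂ K→H

∪-⊑FO : ∀ {C D F} → C ⊑FO F → D ⊑FO F → (C ∪ D) ⊑FO F
∪-⊑FO (T₁ , h₁) (T₂ , h₂) = optional T₁ ⨾ optional T₂ , λ where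
  G (inj₁ G∈C) → let H , H∈F , H→G = h₁ G G∈C in H , H∈F , G , optional-extends T₁ H→G , optional-refl T₂ G
  G (inj₂ G∈D) → let H , H∈F , H→G = h₂ G G∈D in H , H∈F , H , optional-refl T₁ H , optional-extends T₂ H→G

lemma3p5 : IsJoinByUnion _⊑°FO_ × IsJoinByUnion _⊑FO_
lemma3p5 = (λ C D → ⊆⇒⊑°FO inj₁ , ⊆⇒⊑°FO inj₂ , λ F → ∪-⊑°FO)
         , (λ C D → ⊆⇒⊑FO inj₁ , ⊆⇒⊑FO inj₂ , λ F → ∪-⊑FO)
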